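{- Let $\mathcal{S}=[0,C_1]\times\cdots\times[0,C_d]\subset\mathbb{Z}^d$ with the componentwise order, let $\mathcal{B}\subseteq\{1,\dots,d\}$, and let $a$ be an ASHE with direction vector $v$ and blocking relation $\mathcal{R}=\{(i,i): i\in\mathcal{B}\}$, where $|v_i|=1$ for all $i\in\mathcal{B}$. Then for all $m,M\in\mathcal{S}$ with $m\le M$, writing $[m',M']=[m,M]\boxdot a$, we have $\|M'-m'\|_1\le\|M-m\|_1$.
   Context: For $x\in\mathcal{S}$: $CR(x)=\{i: x_i+v_i\notin[0,C_i]\}$ and $B(x)=\{i:\exists j\in CR(x),\ (j,i)\in\mathcal{R}\}$. An event $a$ is an ASHE with direction vector $v\in\mathbb{Z}^d$ and blocking relation $\mathcal{R}$ (a binary relation on $\{1,\dots,d\}$) if for all $x\in\mathcal{S}$ and all $i$: $(x\cdot a)_i=x_i$ if $i\in B(x)$ and $(x\cdot a)_i=\min(\max(x_i+v_i,0),C_i)$ otherwise. $[m,M]=\{x\in\mathcal{S}: m\le x\le M\}$, and $[m,M]\boxdot a=[\inf_{x\in[m,M]}x\cdot a,\ \sup_{x\in[m,M]}x\cdot a]$ (componentwise inf/sup). $\|y\|_1=\sum_i|y_i|$. -}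

module Defs where

open import Data.Nat using (ℕ; zero; suc)
import Data.Nat as ℕ
open import Data.Fin using (Fin; zero; suc)
open import Data.Integer using (ℤ; +_; _+_; _-_; _≤_; _⊓_; _⊔_; ∣_∣)
open import Data.Product using (Σ; _×_; ∃-syntax)
open import Relation.Nullary using (¬_)
open import Relation.Binary.PropositionalEquality using (_≡_)

Pt : ℕ → Set
Pt d = Fin d → ℤ

InS : ∀ {d} → (Fin d → ℕ) → Pt d → Set
InS C x = ∀ i → (+ 0 ≤ x i) × (x i ≤ + C i)

_≤ᵥ_ : ∀ {d} → Pt d → Pt d → Set
x ≤ᵥ y = ∀ i → x i ≤ y i

CR : ∀ {d} → (Fin d → ℕ) → Pt d → Pt d → Fin d → Set
CR C v x i = ¬ ((+ 0 ≤ x i + v i) × (x i + v i ≤ + C i))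

Blocked : ∀ {d} → (Fin d → ℕ) → Pt d → (Fin d → Fin d → Set) → Pt d → Fin d → Set
Blocked C v R x i = ∃[ j ] (CR C v x j × R j i)

clamp : ℕ → ℤ → ℤ
clamp c z = (z ⊔ + 0) ⊓ + c

-- a (an action on states, given as a map on ℤ^d whose values matter only on S)
-- is an ASHE with direction v and blocking relation R
IsASHE : ∀ {d} → (Fin d → ℕ) → Pt d → (Fin d → Fin d → Set) → (Pt d → Pt d) → Set
IsASHE C v R a = ∀ x → InS C x → ∀ i →
  (Blocked C v R x i → a x i ≡ x i) × (¬ Blocked C v R x i → a x i ≡ clamp (C i) (x i + v i))

InBox : ∀ {d} → (Fin d → ℕ) → Pt d → Pt d → Pt d → Set
InBox C m M x = InS C x × (m ≤ᵥ x) × (x ≤ᵥ M)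

IsInfImage : ∀ {d} → (Fin d → ℕ) → (Pt d → Pt d) → Pt d → Pt d → Pt d → Set
IsInfImage C a m M m' = ∀ i →
  (∀ x → InBox C m M x → m' i ≤ a x i) ×
  (∀ l → (∀ x → InBox C m M x → l ≤ a x i) → l ≤ m' i)

IsSupImage : ∀ {d} → (Fin d → ℕ) → (Pt d → Pt d) → Pt d → Pt d → Pt d → Set
IsSupImage C a m M M' = ∀ i →
  (∀ x → InBox C m M x → a x i ≤ M' i) ×
  (∀ u → (∀ x → InBox C m M x → a x i ≤ u) → M' i ≤ u)

sumFin : ∀ {d} → (Fin d → ℕ) → ℕ
sumFin {zero} f = 0
sumFin {suc d} f = f zero ℕ.+ sumFin (λ i → f (suc i))

dist1 : ∀ {d} → Pt d → Pt d → ℕ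
dist1 x y = sumFin (λ i → ∣ y i - x i ∣)

module Submission where

-- With the diagonal blocking relation R = {(i,i) : i ∈ B} and unit steps
-- |v_i| = 1 on B, blocking never changes the outcome: a coordinate i is
-- blocked only when x_i + v_i leaves [0,C_i], and a unit step can only leave
-- the interval from its boundary, where clamping sends it back to x_i.  Hence
-- on S the event acts coordinatewise as the clamped translation
-- z ↦ clamp C_i (z + v_i), a monotone and non-expansive map of ℤ.

open import Defs
open import Data.Nat using (ℕ)
import Data.Nat as ℕ
open import Data.Fin using (Fin)
open import Data.Integer using (∣_∣)
open import Data.Product using (_×_)
open import Relation.Binary.PropositionalEquality using (_≡_)

import Data.Nat.Properties as ℕP
open import Data.Fin using (zero; suc)
open import Data.Integer using (ℤ; +_; -[1+_]; _+_; _-_; -_; _⊔_; _⊓_; _≤_; +≤+)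
open import Data.Integer.Properties
open import Data.Integer.Solver using (module +-*-Solver)
open import Data.Product using (_,_; proj₁; proj₂)
open import Data.Sum using (inj₁; inj₂)
open import Data.Empty using (⊥-elim)
open import Relation.Nullary using (¬_)
open import Relation.Nullary.Decidable using (decidable-stable)
open import Relation.Binary.PropositionalEquality using (refl; sym; trans; cong; subst)

Monotone : (ℤ → ℤ) → Set
Monotone f = ∀ {p q} → p ≤ q → f p ≤ f q

NonExpansive : (ℤ → ℤ) → Set
NonExpansive f = ∀ {p q} → p ≤ q → f q - f p ≤ q - p

translate-nonExpansive : ∀ w → NonExpansive (_+ w)
translate-nonExpansive w {p} {q} _ = ≤-reflexive (difference-invariant q p w)
  where
  open +-*-Solver
  difference-invariant : ∀ q p w → (q + w) - (p + w) ≡ q - p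
  difference-invariant = solve 3 (λ q p w → (q :+ w) :- (p :+ w) := q :- p) refl

⊔-nonExpansive : ∀ k → NonExpansive (_⊔ k)
⊔-nonExpansive k {p} {q} p≤q with ≤-total q k
... | inj₁ q≤k rewrite i≤j⇒i⊔j≡j q≤k | i≤j⇒i⊔j≡j (≤-trans p≤q q≤k) | +-inverseʳ k =
  i≤j⇒0≤j-i p≤q
... | inj₂ k≤q rewrite i≥j⇒i⊔j≡i k≤q with ≤-total p k
...   | inj₁ p≤k rewrite i≤j⇒i⊔j≡j p≤k = +-monoʳ-≤ q (neg-mono-≤ p≤k)
...   | inj₂ k≤p rewrite i≥j⇒i⊔j≡i k≤p = ≤-refl

⊓-nonExpansive : ∀ k → NonExpansive (_⊓ k)
⊓-nonExpansive k {p} {q} p≤q with ≤-total k p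
... | inj₁ k≤p rewrite i≥j⇒i⊓j≡j k≤p | i≥j⇒i⊓j≡j (≤-trans k≤p p≤q) | +-inverseʳ k =
  i≤j⇒0≤j-i p≤q
... | inj₂ p≤k rewrite i≤j⇒i⊓j≡i p≤k with ≤-total q k
...   | inj₁ q≤k rewrite i≤j⇒i⊓j≡i q≤k = ≤-refl
...   | inj₂ k≤q rewrite i≥j⇒i⊓j≡j k≤q = +-monoˡ-≤ (- p) k≤q

∘-nonExpansive : ∀ f g → Monotone g → NonExpansive f → NonExpansive g →
  NonExpansive (λ z → f (g z))
∘-nonExpansive _ _ g-mono f-ne g-ne p≤q = ≤-trans (f-ne (g-mono p≤q)) (g-ne p≤q)

clampedShift : ℕ → ℤ → ℤ → ℤ
clampedShift c w z = clamp c (z + w)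

clampedShift-monotone : ∀ c w → Monotone (clampedShift c w)
clampedShift-monotone c w p≤q = ⊓-monoˡ-≤ (+ c) (⊔-monoˡ-≤ (+ 0) (+-monoˡ-≤ w p≤q))

clampedShift-nonExpansive : ∀ c w → NonExpansive (clampedShift c w)
clampedShift-nonExpansive c w =
  ∘-nonExpansive (clamp c) (_+ w) (+-monoˡ-≤ w)
    (∘-nonExpansive (_⊓ + c) (_⊔ + 0) (⊔-monoˡ-≤ (+ 0)) (⊓-nonExpansive (+ c)) (⊔-nonExpansive (+ 0)))
    (translate-nonExpansive w)

clamp-above : ∀ c {z} → + c ≤ z → clamp c z ≡ + c
clamp-above c {z} c≤z = i≥j⇒i⊓j≡j (≤-trans c≤z (i≤i⊔j z (+ 0)))

-- A unit step that leaves [0,c] from a point z of [0,c] is undone by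
-- clamping: such a step starts at the boundary and points outwards.
clamp-undoes-escaping-unit-step : ∀ c {z} w → ∣ w ∣ ≡ 1 → + 0 ≤ z → z ≤ + c →
  ¬ ((+ 0 ≤ z + w) × (z + w ≤ + c)) → clamp c (z + w) ≡ z
clamp-undoes-escaping-unit-step c (+ 1) _ (+≤+ {n = n} _) (+≤+ n≤c) escapes =
  trans (clamp-above c (+≤+ (ℕP.<⇒≤ c<n+1))) (cong +_ (ℕP.≤-antisym c≤n n≤c))
  where
  c<n+1 : c ℕ.< n ℕ.+ 1
  c<n+1 = ℕP.≰⇒> (λ n+1≤c → escapes (+≤+ ℕ.z≤n , +≤+ n+1≤c))
  c≤n : c ℕ.≤ n
  c≤n = ℕP.m<1+n⇒m≤n (subst (c ℕ.<_) (ℕP.+-comm n 1) c<n+1)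
clamp-undoes-escaping-unit-step c -[1+ 0 ] _ (+≤+ {n = 0} _) _ _ = refl
clamp-undoes-escaping-unit-step c -[1+ 0 ] _ (+≤+ {n = ℕ.suc k} _) (+≤+ k+1≤c) escapes =
  ⊥-elim (escapes (+≤+ ℕ.z≤n , +≤+ (ℕP.≤-trans (ℕP.n≤1+n k) k+1≤c)))
clamp-undoes-escaping-unit-step c (+ 0) () _ _ _
clamp-undoes-escaping-unit-step c (+ ℕ.suc (ℕ.suc _)) () _ _ _
clamp-undoes-escaping-unit-step c -[1+ ℕ.suc _ ] () _ _ _

Diagonal : ∀ {d} → (Fin d → Set) → Fin d → Fin d → Set
Diagonal Bset j i = (j ≡ i) × Bset i

-- Blockedness need not be
-- decidable, but the conclusion is a decidable equation, so it suffices to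
-- refute its negation in both the blocked and the unblocked case.
diagonalASHE-acts-as-clampedShift : ∀ {d} (C : Fin d → ℕ) (Bset : Fin d → Set) v a →
  IsASHE C v (Diagonal Bset) a → (∀ i → Bset i → ∣ v i ∣ ≡ 1) →
  ∀ x → InS C x → ∀ i → a x i ≡ clampedShift (C i) (v i) (x i)
diagonalASHE-acts-as-clampedShift C Bset v a ashe unit x x∈S i =
  decidable-stable (a x i ≟ clampedShift (C i) (v i) (x i))
    (λ differs → differs (proj₂ (ashe x x∈S i) (λ blocked → differs (whenBlocked blocked))))
  where
  whenBlocked : Blocked C v (Diagonal Bset) x i → a x i ≡ clampedShift (C i) (v i) (x i)
  whenBlocked blocked@(_ , escapes , refl , i∈B) =
    trans (proj₁ (ashe x x∈S i) blocked)
      (sym (clamp-undoes-escaping-unit-step (C i) (v i) (unit i i∈B)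
             (proj₁ (x∈S i)) (proj₂ (x∈S i)) escapes))

sumFin-mono : ∀ {d} (f g : Fin d → ℕ) → (∀ i → f i ℕ.≤ g i) → sumFin f ℕ.≤ sumFin g
sumFin-mono {ℕ.zero} f g f≤g = ℕ.z≤n
sumFin-mono {ℕ.suc d} f g f≤g =
  ℕP.+-mono-≤ (f≤g zero) (sumFin-mono (λ i → f (suc i)) (λ i → g (suc i)) (λ i → f≤g (suc i)))

∣∣-mono-nonneg : ∀ {p q} → + 0 ≤ p → p ≤ q → ∣ p ∣ ℕ.≤ ∣ q ∣
∣∣-mono-nonneg (+≤+ _) (+≤+ p≤q) = p≤q

-- If an action is given on S coordinatewise by monotone non-expansive maps
-- f_i, then the image box [m',M'] of a box [m,M] satisfies
-- f_i(m_i) ≤ m'_i ≤ M'_i ≤ f_i(M_i), so its ℓ¹ width is at most that of [m,M].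
coordinatewise-action-contracts-boxes : ∀ {d} (C : Fin d → ℕ) (a : Pt d → Pt d)
  (f : Fin d → ℤ → ℤ) → (∀ i → Monotone (f i)) → (∀ i → NonExpansive (f i)) →
  (∀ x → InS C x → ∀ i → a x i ≡ f i (x i)) →
  (m M : Pt d) → InS C m → m ≤ᵥ M →
  (m' M' : Pt d) → IsInfImage C a m M m' → IsSupImage C a m M M' →
  dist1 m' M' ℕ.≤ dist1 m M
coordinatewise-action-contracts-boxes C a f mono nonExp acts m M m∈S m≤M m' M' inf sup =
  sumFin-mono _ _ side-shrinks
  where
  m∈box : InBox C m M m
  m∈box = m∈S , (λ i → ≤-refl) , m≤M

  lower : ∀ i → f i (m i) ≤ m' i
  lower i = proj₂ (inf i) _ λ x (x∈S , m≤x , _) →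
    subst (f i (m i) ≤_) (sym (acts x x∈S i)) (mono i (m≤x i))

  upper : ∀ i → M' i ≤ f i (M i)
  upper i = proj₂ (sup i) _ λ x (x∈S , _ , x≤M) →
    subst (_≤ f i (M i)) (sym (acts x x∈S i)) (mono i (x≤M i))

  side-shrinks : ∀ i → ∣ M' i - m' i ∣ ℕ.≤ ∣ M i - m i ∣
  side-shrinks i = ∣∣-mono-nonneg (i≤j⇒0≤j-i m'≤M') side≤
    where
    m'≤M' : m' i ≤ M' i
    m'≤M' = ≤-trans (proj₁ (inf i) m m∈box) (proj₁ (sup i) m m∈box)
    side≤ : M' i - m' i ≤ M i - m i
    side≤ = ≤-trans (+-mono-≤ (upper i) (neg-mono-≤ (lower i))) (nonExp i (m≤M i))

corollary2 : (d : ℕ) (C : Fin d → ℕ) (Bset : Fin d → Set) (v : Pt d) (a : Pt d → Pt d) →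
    IsASHE C v (λ j i → (j ≡ i) × Bset i) a →
    (∀ i → Bset i → ∣ v i ∣ ≡ 1) →
    (m M : Pt d) → InS C m → InS C M → m ≤ᵥ M →
    (m' M' : Pt d) → IsInfImage C a m M m' → IsSupImage C a m M M' →
    dist1 m' M' ℕ.≤ dist1 m M
corollary2 d C Bset v a ashe unit m M m∈S _ m≤M =
  coordinatewise-action-contracts-boxes C a (λ i → clampedShift (C i) (v i))
    (λ i → clampedShift-monotone (C i) (v i))
    (λ i → clampedShift-nonExpansive (C i) (v i))
    (diagonalASHE-acts-as-clampedShift C Bset v a ashe unit)
    m M m∈S m≤M
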